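{- Let $\mathcal{V}$ be a (strict) monoidal category with unit $I$, let $A$ and $C$ be pseudo-affine objects, and let $f: A\otimes B_0\to A\otimes B_1$ and $g: B_0\otimes C\to B_1\otimes C$ be morphisms with $f\otimes C=A\otimes g: A\otimes B_0\otimes C\to A\otimes B_1\otimes C$. Then there exists $h: B_0\to B_1$ such that $f=A\otimes h$ and $g=h\otimes C$.
   Context: An object $A$ is pseudo-affine if there exist morphisms $p:I\to A$ and $c:A\to I$ with $c\circ p=\mathrm{id}_I$. -}

module Defs where

open import Level using (Level; _⊔_; suc)
open import Relation.Binary.PropositionalEquality using (_≡_; refl)
open import Data.Product using (Σ; ∃; _×_; _,_)

cast : ∀ {o ℓ} {Obj : Set o} (Hom : Obj → Obj → Set ℓ) {A A′ B B′ : Obj} →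
       A ≡ A′ → B ≡ B′ → Hom A B → Hom A′ B′
cast Hom refl refl f = f

-- A strict monoidal category: the associativity and unit laws hold as
-- equalities of objects, and the corresponding laws for morphisms hold
-- up to transport along those object equalities.
record StrictMonoidalCategory (o ℓ : Level) : Set (suc (o ⊔ ℓ)) where
  infixr 9 _∘_
  infixr 10 _⊗₀_ _⊗₁_
  field
    Obj  : Set o
    Hom  : Obj → Obj → Set ℓ
    id   : ∀ {A} → Hom A A
    _∘_  : ∀ {A B C} → Hom B C → Hom A B → Hom A C
    identityˡ : ∀ {A B} (f : Hom A B) → id ∘ f ≡ f
    identityʳ : ∀ {A B} (f : Hom A B) → f ∘ id ≡ f
    assoc     : ∀ {A B C D} (f : Hom A B) (g : Hom B C) (h : Hom C D) →
                (h ∘ g) ∘ f ≡ h ∘ (g ∘ f)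

    I     : Obj
    _⊗₀_  : Obj → Obj → Obj
    _⊗₁_  : ∀ {A B C D} → Hom A B → Hom C D → Hom (A ⊗₀ C) (B ⊗₀ D)
    ⊗-identity : ∀ {A B} → id {A} ⊗₁ id {B} ≡ id
    ⊗-homomorphism : ∀ {A B C D E F} (f : Hom A B) (g : Hom B C)
                       (h : Hom D E) (k : Hom E F) →
                     (g ∘ f) ⊗₁ (k ∘ h) ≡ (g ⊗₁ k) ∘ (f ⊗₁ h)

    unitˡ₀ : ∀ A → I ⊗₀ A ≡ A
    unitʳ₀ : ∀ A → A ⊗₀ I ≡ A
    assoc₀ : ∀ A B C → (A ⊗₀ B) ⊗₀ C ≡ A ⊗₀ (B ⊗₀ C)

    unitˡ₁ : ∀ {A B} (f : Hom A B) →
             cast Hom (unitˡ₀ A) (unitˡ₀ B) (id {I} ⊗₁ f) ≡ f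
    unitʳ₁ : ∀ {A B} (f : Hom A B) →
             cast Hom (unitʳ₀ A) (unitʳ₀ B) (f ⊗₁ id {I}) ≡ f
    assoc₁ : ∀ {A B C D E F} (f : Hom A B) (g : Hom C D) (h : Hom E F) →
             cast Hom (assoc₀ A C E) (assoc₀ B D F) ((f ⊗₁ g) ⊗₁ h)
               ≡ f ⊗₁ (g ⊗₁ h)

module _ {o ℓ} (𝒱 : StrictMonoidalCategory o ℓ) where
  open StrictMonoidalCategory 𝒱

  PseudoAffine : Obj → Set ℓ
  PseudoAffine A = Σ (Hom I A) λ p → Σ (Hom A I) λ c → c ∘ p ≡ id {I}

module Submission where

open import Defs
open import Relation.Binary.PropositionalEquality
  using (_≡_; refl; sym; trans; cong; cong₂; module ≡-Reasoning)
open import Data.Product using (Σ; _×_; _,_)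

-- Take h := (c ⊗ B₁) ∘ f ∘ (p ⊗ B₀) for a retraction c ∘ p = id_I on A.
-- Sandwiching the hypothesis between c ⊗ B₁ ⊗ C and p ⊗ B₀ ⊗ C gives
-- I ⊗ g = h ⊗ C, so g = h ⊗ C.  Sandwiching it between A ⊗ B₁ ⊗ c and
-- A ⊗ B₀ ⊗ p for a retraction on C then gives f ⊗ I = A ⊗ h ⊗ I, so f = A ⊗ h.

module _ {o ℓ} (𝒱 : StrictMonoidalCategory o ℓ) where
  open StrictMonoidalCategory 𝒱
  open ≡-Reasoning

  cast-∘ : ∀ {A A′ B B′ C C′} (p : A ≡ A′) (q : B ≡ B′) (r : C ≡ C′)
           (g : Hom B C) (f : Hom A B) →
           cast Hom p r (g ∘ f) ≡ cast Hom q r g ∘ cast Hom p q f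
  cast-∘ refl refl refl g f = refl

  cast-injective : ∀ {A A′ B B′} (p : A ≡ A′) (q : B ≡ B′) {f g : Hom A B} →
                   cast Hom p q f ≡ cast Hom p q g → f ≡ g
  cast-injective refl refl e = e

  identity-sandwich : ∀ {A B} (f : Hom A B) → id ∘ f ∘ id ≡ f
  identity-sandwich f = trans (identityˡ _) (identityʳ f)

  ⊗-homomorphism₃ : ∀ {A B C D A′ B′ C′ D′}
                    (a : Hom C D) (b : Hom B C) (c : Hom A B)
                    (a′ : Hom C′ D′) (b′ : Hom B′ C′) (c′ : Hom A′ B′) →
                    (a ∘ b ∘ c) ⊗₁ (a′ ∘ b′ ∘ c′) ≡ (a ⊗₁ a′) ∘ (b ⊗₁ b′) ∘ (c ⊗₁ c′)
  ⊗-homomorphism₃ a b c a′ b′ c′ =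
    trans (⊗-homomorphism (b ∘ c) a (b′ ∘ c′) a′)
          (cong ((a ⊗₁ a′) ∘_) (⊗-homomorphism c b c′ b′))

  id-I-⊗-injective : ∀ {A B} {f g : Hom A B} → id {I} ⊗₁ f ≡ id {I} ⊗₁ g → f ≡ g
  id-I-⊗-injective {f = f} {g} e =
    trans (sym (unitˡ₁ f)) (trans (cong (cast Hom (unitˡ₀ _) (unitˡ₀ _)) e) (unitˡ₁ g))

  ⊗-id-I-injective : ∀ {A B} {f g : Hom A B} → f ⊗₁ id {I} ≡ g ⊗₁ id {I} → f ≡ g
  ⊗-id-I-injective {f = f} {g} e =
    trans (sym (unitʳ₁ f)) (trans (cong (cast Hom (unitʳ₀ _) (unitʳ₀ _)) e) (unitʳ₁ g))

  id-I-⊗-unitˡ : ∀ {A B} (f : Hom (I ⊗₀ A) (I ⊗₀ B)) →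
                 f ≡ id {I} ⊗₁ cast Hom (unitˡ₀ A) (unitˡ₀ B) f
  id-I-⊗-unitˡ f = cast-injective (unitˡ₀ _) (unitˡ₀ _) (sym (unitˡ₁ (cast Hom _ _ f)))

  ⊗-assoc-sandwich :
    ∀ {X₀ X₁ X₂ X₃ Y₀ Y₁ Y₂ Y₃ Z₀ Z₁ Z₂ Z₃}
    (a : Hom X₂ X₃) (a′ : Hom Y₂ Y₃) (a″ : Hom Z₂ Z₃)
    (u : Hom (X₁ ⊗₀ Y₁) (X₂ ⊗₀ Y₂)) (v : Hom Z₁ Z₂)
    (c : Hom X₀ X₁) (c′ : Hom Y₀ Y₁) (c″ : Hom Z₀ Z₁) →
    (a ⊗₁ (a′ ⊗₁ a″)) ∘ cast Hom (assoc₀ X₁ Y₁ Z₁) (assoc₀ X₂ Y₂ Z₂) (u ⊗₁ v)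
      ∘ (c ⊗₁ (c′ ⊗₁ c″))
    ≡ cast Hom (assoc₀ X₀ Y₀ Z₀) (assoc₀ X₃ Y₃ Z₃)
        (((a ⊗₁ a′) ∘ u ∘ (c ⊗₁ c′)) ⊗₁ (a″ ∘ v ∘ c″))
  ⊗-assoc-sandwich {X₀} {X₁} {X₂} {X₃} {Y₀} {Y₁} {Y₂} {Y₃} {Z₀} {Z₁} {Z₂} {Z₃}
                   a a′ a″ u v c c′ c″ = begin
    (a ⊗₁ (a′ ⊗₁ a″)) ∘ cast Hom α₁ α₂ (u ⊗₁ v) ∘ (c ⊗₁ (c′ ⊗₁ c″))
      ≡⟨ cong₂ (λ l r → l ∘ cast Hom α₁ α₂ (u ⊗₁ v) ∘ r)
               (sym (assoc₁ a a′ a″)) (sym (assoc₁ c c′ c″)) ⟩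
    cast Hom α₂ α₃ ((a ⊗₁ a′) ⊗₁ a″) ∘ cast Hom α₁ α₂ (u ⊗₁ v)
      ∘ cast Hom α₀ α₁ ((c ⊗₁ c′) ⊗₁ c″)
      ≡⟨ cong (cast Hom α₂ α₃ ((a ⊗₁ a′) ⊗₁ a″) ∘_) (sym (cast-∘ α₀ α₁ α₂ _ _)) ⟩
    cast Hom α₂ α₃ ((a ⊗₁ a′) ⊗₁ a″) ∘ cast Hom α₀ α₂ ((u ⊗₁ v) ∘ ((c ⊗₁ c′) ⊗₁ c″))
      ≡⟨ sym (cast-∘ α₀ α₂ α₃ _ _) ⟩
    cast Hom α₀ α₃ (((a ⊗₁ a′) ⊗₁ a″) ∘ (u ⊗₁ v) ∘ ((c ⊗₁ c′) ⊗₁ c″))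
      ≡⟨ cong (cast Hom α₀ α₃) (sym (⊗-homomorphism₃ (a ⊗₁ a′) u (c ⊗₁ c′) a″ v c″)) ⟩
    cast Hom α₀ α₃ (((a ⊗₁ a′) ∘ u ∘ (c ⊗₁ c′)) ⊗₁ (a″ ∘ v ∘ c″)) ∎
    where
    α₀ : (X₀ ⊗₀ Y₀) ⊗₀ Z₀ ≡ X₀ ⊗₀ (Y₀ ⊗₀ Z₀)
    α₀ = assoc₀ X₀ Y₀ Z₀
    α₁ : (X₁ ⊗₀ Y₁) ⊗₀ Z₁ ≡ X₁ ⊗₀ (Y₁ ⊗₀ Z₁)
    α₁ = assoc₀ X₁ Y₁ Z₁
    α₂ : (X₂ ⊗₀ Y₂) ⊗₀ Z₂ ≡ X₂ ⊗₀ (Y₂ ⊗₀ Z₂)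
    α₂ = assoc₀ X₂ Y₂ Z₂
    α₃ : (X₃ ⊗₀ Y₃) ⊗₀ Z₃ ≡ X₃ ⊗₀ (Y₃ ⊗₀ Z₃)
    α₃ = assoc₀ X₃ Y₃ Z₃

  retraction-sandwich : ∀ {A} {p : Hom I A} {c : Hom A I} → c ∘ p ≡ id → c ∘ id ∘ p ≡ id
  retraction-sandwich {p = p} {c} c∘p≡id = trans (cong (c ∘_) (identityˡ p)) c∘p≡id

  retraction-⊗-sandwichˡ : ∀ {A B C} {p : Hom I A} {c : Hom A I} → c ∘ p ≡ id →
                           (x : Hom B C) → (c ⊗₁ id) ∘ (id ⊗₁ x) ∘ (p ⊗₁ id) ≡ id {I} ⊗₁ x
  retraction-⊗-sandwichˡ {p = p} {c} c∘p≡id x =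
    trans (sym (⊗-homomorphism₃ c id p id x id))
          (cong₂ _⊗₁_ (retraction-sandwich c∘p≡id) (identity-sandwich x))

  retraction-⊗-sandwichʳ : ∀ {A B C} {p : Hom I A} {c : Hom A I} → c ∘ p ≡ id →
                           (x : Hom B C) → (id ⊗₁ c) ∘ (x ⊗₁ id) ∘ (id ⊗₁ p) ≡ x ⊗₁ id {I}
  retraction-⊗-sandwichʳ {p = p} {c} c∘p≡id x =
    trans (sym (⊗-homomorphism₃ id x id c id p))
          (cong₂ _⊗₁_ (identity-sandwich x) (retraction-sandwich c∘p≡id))

  stripˡ : ∀ {A B₀ B₁} → Hom I A → Hom A I → Hom (A ⊗₀ B₀) (A ⊗₀ B₁) → Hom B₀ B₁
  stripˡ {B₀ = B₀} {B₁} p c f = cast Hom (unitˡ₀ B₀) (unitˡ₀ B₁) ((c ⊗₁ id) ∘ f ∘ (p ⊗₁ id))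

  module _ {A B₀ B₁ C : Obj}
           (f : Hom (A ⊗₀ B₀) (A ⊗₀ B₁)) (g : Hom (B₀ ⊗₀ C) (B₁ ⊗₀ C))
           (f⊗C≡A⊗g : cast Hom (assoc₀ A B₀ C) (assoc₀ A B₁ C) (f ⊗₁ id {C}) ≡ id {A} ⊗₁ g)
           where

    g≡stripˡ-⊗-id : {p : Hom I A} {c : Hom A I} → c ∘ p ≡ id → g ≡ stripˡ p c f ⊗₁ id {C}
    g≡stripˡ-⊗-id {p} {c} c∘p≡id = id-I-⊗-injective (begin
      id ⊗₁ g
        ≡⟨ sym (retraction-⊗-sandwichˡ c∘p≡id g) ⟩
      (c ⊗₁ id) ∘ (id ⊗₁ g) ∘ (p ⊗₁ id)
        ≡⟨ cong (λ m → (c ⊗₁ id) ∘ m ∘ (p ⊗₁ id)) (sym f⊗C≡A⊗g) ⟩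
      (c ⊗₁ id) ∘ cast Hom (assoc₀ A B₀ C) (assoc₀ A B₁ C) (f ⊗₁ id) ∘ (p ⊗₁ id)
        ≡⟨ cong₂ (λ l r → (c ⊗₁ l) ∘ cast Hom (assoc₀ A B₀ C) (assoc₀ A B₁ C) (f ⊗₁ id) ∘ (p ⊗₁ r))
                 (sym ⊗-identity) (sym ⊗-identity) ⟩
      (c ⊗₁ (id ⊗₁ id)) ∘ cast Hom (assoc₀ A B₀ C) (assoc₀ A B₁ C) (f ⊗₁ id) ∘ (p ⊗₁ (id ⊗₁ id))
        ≡⟨ ⊗-assoc-sandwich c id id f id p id id ⟩
      cast Hom (assoc₀ I B₀ C) (assoc₀ I B₁ C) (((c ⊗₁ id) ∘ f ∘ (p ⊗₁ id)) ⊗₁ (id ∘ id ∘ id))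
        ≡⟨ cong₂ (λ l r → cast Hom (assoc₀ I B₀ C) (assoc₀ I B₁ C) (l ⊗₁ r))
                 (id-I-⊗-unitˡ _) (identity-sandwich id) ⟩
      cast Hom (assoc₀ I B₀ C) (assoc₀ I B₁ C) ((id ⊗₁ stripˡ p c f) ⊗₁ id)
        ≡⟨ assoc₁ id (stripˡ p c f) id ⟩
      id ⊗₁ (stripˡ p c f ⊗₁ id) ∎)

    f≡id-⊗ : {p : Hom I C} {c : Hom C I} → c ∘ p ≡ id →
            (h : Hom B₀ B₁) → g ≡ h ⊗₁ id {C} → f ≡ id {A} ⊗₁ h
    f≡id-⊗ {p} {c} c∘p≡id h g≡h⊗C =
      ⊗-id-I-injective (cast-injective (assoc₀ A B₀ I) (assoc₀ A B₁ I) (begin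
        cast Hom (assoc₀ A B₀ I) (assoc₀ A B₁ I) (f ⊗₁ id)
          ≡⟨ cong₂ (λ l r → cast Hom (assoc₀ A B₀ I) (assoc₀ A B₁ I) (l ⊗₁ r))
                   (sym (trans (cong₂ (λ l r → l ∘ f ∘ r) ⊗-identity ⊗-identity)
                               (identity-sandwich f)))
                   (sym (retraction-sandwich c∘p≡id)) ⟩
        cast Hom (assoc₀ A B₀ I) (assoc₀ A B₁ I)
          (((id ⊗₁ id) ∘ f ∘ (id ⊗₁ id)) ⊗₁ (c ∘ id ∘ p))
          ≡⟨ sym (⊗-assoc-sandwich id id c f id id id p) ⟩
        (id ⊗₁ (id ⊗₁ c)) ∘ cast Hom (assoc₀ A B₀ C) (assoc₀ A B₁ C) (f ⊗₁ id)
          ∘ (id ⊗₁ (id ⊗₁ p))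
          ≡⟨ cong (λ m → (id ⊗₁ (id ⊗₁ c)) ∘ m ∘ (id ⊗₁ (id ⊗₁ p)))
                  (trans f⊗C≡A⊗g (cong (id ⊗₁_) g≡h⊗C)) ⟩
        (id ⊗₁ (id ⊗₁ c)) ∘ (id ⊗₁ (h ⊗₁ id)) ∘ (id ⊗₁ (id ⊗₁ p))
          ≡⟨ sym (⊗-homomorphism₃ id id id (id ⊗₁ c) (h ⊗₁ id) (id ⊗₁ p)) ⟩
        (id ∘ id ∘ id) ⊗₁ ((id ⊗₁ c) ∘ (h ⊗₁ id) ∘ (id ⊗₁ p))
          ≡⟨ cong₂ _⊗₁_ (identity-sandwich id) (retraction-⊗-sandwichʳ c∘p≡id h) ⟩
        id ⊗₁ (h ⊗₁ id)
          ≡⟨ sym (assoc₁ id h id) ⟩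
        cast Hom (assoc₀ A B₀ I) (assoc₀ A B₁ I) ((id ⊗₁ h) ⊗₁ id) ∎))

mainTheorem18 : ∀ {o ℓ} (𝒱 : StrictMonoidalCategory o ℓ) →
    let open StrictMonoidalCategory 𝒱 in
    ∀ {A B₀ B₁ C : Obj} → PseudoAffine 𝒱 A → PseudoAffine 𝒱 C →
    (f : Hom (A ⊗₀ B₀) (A ⊗₀ B₁)) → (g : Hom (B₀ ⊗₀ C) (B₁ ⊗₀ C)) →
    cast Hom (assoc₀ A B₀ C) (assoc₀ A B₁ C) (f ⊗₁ id {C}) ≡ id {A} ⊗₁ g →
    Σ (Hom B₀ B₁) λ h → (f ≡ id {A} ⊗₁ h) × (g ≡ h ⊗₁ id {C})
mainTheorem18 𝒱 {A} {B₀} {B₁} {C} (pA , cA , cA∘pA≡id) (pC , cC , cC∘pC≡id) f g f⊗C≡A⊗g =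
  h , f≡id-⊗ 𝒱 f g f⊗C≡A⊗g cC∘pC≡id h g≡h⊗C , g≡h⊗C
  where
  open StrictMonoidalCategory 𝒱
  h : Hom B₀ B₁
  h = stripˡ 𝒱 pA cA f
  g≡h⊗C : g ≡ h ⊗₁ id {C}
  g≡h⊗C = g≡stripˡ-⊗-id 𝒱 f g f⊗C≡A⊗g cA∘pA≡id
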